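{- Let $a,b$ be positive integers. If a finite graph $G$ contains a parity handle $H$ and $G-\mathrm{int}(H)$ is $(a,b)$-colorable, then $G$ is $(a,b)$-colorable.
   Context: An $(a,b)$-coloring assigns to each vertex a $b$-subset of $\{1,\ldots,a\}$ with adjacent vertices receiving disjoint sets. A handle $P(n)$ of length $n$ in $G$ is a path of length $n$ that is an induced subgraph of $G$ whose vertices of degree 2 in the path have degree 2 in $G$; its interior $\mathrm{int}(P(n))$ is the set of its degree-2 vertices. A parity handle $PP(n)$ is a handle $P(n)$ such that $G-\mathrm{int}(P(n))$ contains another path of length $m\le n$ with $m\equiv n\pmod 2$ between the two end-vertices of $P(n)$. -}

module Defs where

open import Data.Nat using (ℕ; zero; suc; _≤_; _<_)
open import Data.Nat.DivMod using (_%_)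
open import Data.Bool using (Bool; true; false)
open import Data.Fin using (Fin; toℕ; inject₁; fromℕ)
open import Data.Fin.Subset using (Subset; ∣_∣; _∩_; ⊥)
open import Data.Vec using (tabulate)
open import Data.Product using (Σ; ∃; _×_; _,_)
open import Data.Sum using (_⊎_)
open import Function.Definitions using (Injective)
open import Relation.Binary.PropositionalEquality using (_≡_)

record Graph : Set where
  field
    N      : ℕ
    adj    : Fin N → Fin N → Bool
    sym    : ∀ u v → adj u v ≡ adj v u
    irrefl : ∀ v → adj v v ≡ false

open Graph public

Adj : (G : Graph) → Fin (N G) → Fin (N G) → Set
Adj G u v = adj G u v ≡ true

degree : (G : Graph) → Fin (N G) → ℕ
degree G v = ∣ tabulate (adj G v) ∣

record Path (G : Graph) (len : ℕ) : Set where
  field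
    vtx      : Fin (suc len) → Fin (N G)
    distinct : Injective _≡_ _≡_ vtx
    step     : ∀ (i : Fin len) → Adj G (vtx (inject₁ i)) (vtx (Fin.suc i))

open Path public

start : ∀ {G len} → Path G len → Fin (N G)
start P = vtx P Fin.zero

end : ∀ {G len} → Path G len → Fin (N G)
end {len = len} P = vtx P (fromℕ len)

Interior : ∀ {G len} → Path G len → Fin (N G) → Set
Interior {len = len} P v =
  Σ (Fin (suc len)) λ i → (0 < toℕ i) × (toℕ i < len) × (vtx P i ≡ v)

IsHandle : ∀ {G len} → Path G len → Set
IsHandle {G} {len} P =
  (∀ (i j : Fin (suc len)) → Adj G (vtx P i) (vtx P j) →
     (toℕ i ≡ suc (toℕ j)) ⊎ (toℕ j ≡ suc (toℕ i)))
  × (∀ (i : Fin (suc len)) → 0 < toℕ i → toℕ i < len → degree G (vtx P i) ≡ 2)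

Avoids : ∀ {G len} → Path G len → (Fin (N G) → Set) → Set
Avoids {len = len} Q X = ∀ (i : Fin (suc len)) → X (vtx Q i) → Data.Empty.⊥
  where import Data.Empty

IsParityHandle : ∀ {G n} → Path G n → Set
IsParityHandle {G} {n} P =
  IsHandle P ×
  Σ ℕ λ m → Σ (Path G m) λ Q →
    (m ≤ n) × (m % 2 ≡ n % 2) ×
    Avoids Q (Interior P) × (start Q ≡ start P) × (end Q ≡ end P)

-- (a,b)-colouring of the subgraph induced by the vertices satisfying S:
-- each vertex of S receives a b-subset of Fin a (= {1,…,a}),
-- adjacent vertices of S receive disjoint sets.
-- (Values of c outside S are irrelevant.)
ColorableOn : (G : Graph) → (a b : ℕ) → (Fin (N G) → Set) → Set
ColorableOn G a b S =
  Σ (Fin (N G) → Subset a) λ c →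
    (∀ v → S v → ∣ c v ∣ ≡ b) ×
    (∀ u v → S u → S v → Adj G u v → (c u ∩ c v) ≡ ⊥)

Colorable : (G : Graph) → (a b : ℕ) → Set
Colorable G a b = ColorableOn G a b (λ _ → Data.Unit.⊤)
  where import Data.Unit

{-# OPTIONS --safe #-}
-- Let Q be the path of length m ≤ n, m ≡ n (mod 2), joining the ends of the handle H
-- outside its interior. Running along Q and then back and forth on its last edge is a
-- walk of length exactly n between the ends of H, and its colours, copied onto H,
-- colour the interior. The result is proper because an interior vertex has degree 2,
-- so all its neighbours are its neighbours on H.
module Submission where

open import Defs
open import Data.Nat using (ℕ; _>_)
open import Data.Empty using (⊥)

open import Data.Nat using (zero; suc; _≤_; _<_; z≤n; s≤s; _≤?_; _<?_)
open import Data.Nat.Properties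
  using (≤-refl; ≤-trans; ≤-antisym; <⇒≤; <⇒≢; n≤1+n; m≤n⇒m<n∨m≡n)
open import Data.Nat.DivMod using (_%_)
open import Data.Fin as Fin using (Fin; toℕ; inject₁; fromℕ; fromℕ<)
open import Data.Fin.Properties using (toℕ-inject₁; toℕ-fromℕ; toℕ-fromℕ<; any?; _≟_)
open import Data.Fin.Subset using (Subset; ∣_∣; _∩_; _∈_; _-_) renaming (⊥ to ∅)
open import Data.Fin.Subset.Properties using (x∈p⇒∣p-x∣<∣p∣; x∈p∧x≢y⇒x∈p-y; ∩-comm)
open import Data.Vec using (tabulate)
open import Data.Vec.Properties using (lookup⇒[]=; lookup∘tabulate)
open import Data.Product using (Σ; _×_; _,_; proj₁)
open import Data.Sum using (_⊎_; inj₁; inj₂)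
open import Relation.Nullary using (¬_; Dec; yes; no; contradiction)
open import Relation.Nullary.Decidable using (_×-dec_)
open import Relation.Binary.PropositionalEquality
  using (_≡_; _≢_; refl; trans; cong; subst; subst₂) renaming (sym to ≡-sym)

Consecutive : ℕ → ℕ → Set
Consecutive j k = (k ≡ suc j) ⊎ (j ≡ suc k)

%2-suc : ∀ n → n % 2 ≢ suc n % 2
%2-suc zero ()
%2-suc (suc zero) ()
%2-suc (suc (suc n)) = %2-suc n

-- The indices 0, 1, …, m, m - 1, m, m - 1, … of a walk that runs along a path
-- of length m and then oscillates on its last edge.
bounce : ℕ → ℕ → ℕ
bounce m zero = zero
bounce m (suc zero) = suc zero
bounce m (suc (suc k)) with suc (suc k) ≤? m
... | yes _ = suc (suc k)
... | no _ = bounce m k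

bounce-id : ∀ {m k} → k ≤ m → bounce m k ≡ k
bounce-id {k = zero} _ = refl
bounce-id {k = suc zero} _ = refl
bounce-id {m} {suc (suc k)} 2+k≤m with suc (suc k) ≤? m
... | yes _ = refl
... | no 2+k≰m = contradiction 2+k≤m 2+k≰m

bounce-beyond : ∀ {m k} → ¬ suc (suc k) ≤ m → bounce m (suc (suc k)) ≡ bounce m k
bounce-beyond {m} {k} 2+k≰m with suc (suc k) ≤? m
... | yes 2+k≤m = contradiction 2+k≤m 2+k≰m
... | no _ = refl

bounce-≤ : ∀ {m} k → 0 < m → bounce m k ≤ m
bounce-≤ zero _ = z≤n
bounce-≤ (suc zero) 0<m = 0<m
bounce-≤ {m} (suc (suc k)) 0<m with suc (suc k) ≤? m
... | yes 2+k≤m = 2+k≤m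
... | no _ = bounce-≤ k 0<m

bounce-consecutive : ∀ m k → Consecutive (bounce m k) (bounce m (suc k))
bounce-consecutive m zero = inj₁ refl
bounce-consecutive m (suc zero) with 2 ≤? m
... | yes _ = inj₁ refl
... | no _ = inj₂ refl
bounce-consecutive m (suc (suc k)) with suc (suc (suc k)) ≤? m | suc (suc k) ≤? m
... | yes _ | yes _ = inj₁ refl
... | yes 3+k≤m | no 2+k≰m = contradiction (≤-trans (n≤1+n _) 3+k≤m) 2+k≰m
... | no _ | yes 2+k≤m = inj₂ (cong suc (≡-sym (bounce-id (≤-trans (n≤1+n _) 2+k≤m))))
... | no _ | no _ = bounce-consecutive m k

≤-same-parity : ∀ {m n} → m ≤ suc (suc n) → m ≢ suc (suc n) → m % 2 ≡ n % 2 → m ≤ n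
≤-same-parity {m} {n} m≤2+n m≢2+n parity with m≤n⇒m<n∨m≡n m≤2+n
... | inj₂ m≡2+n = contradiction m≡2+n m≢2+n
... | inj₁ (s≤s m≤1+n) with m≤n⇒m<n∨m≡n m≤1+n
...   | inj₁ (s≤s m≤n) = m≤n
...   | inj₂ refl = contradiction (≡-sym parity) (%2-suc n)

bounce-same-parity : ∀ {m n} → m ≤ n → m % 2 ≡ n % 2 → bounce m n ≡ m
bounce-same-parity {m} {n} m≤n parity with n ≤? m
... | yes n≤m = trans (bounce-id n≤m) (≤-antisym n≤m m≤n)
bounce-same-parity {m} {zero} m≤0 _ | no 0≰m = contradiction z≤n 0≰m
bounce-same-parity {zero} {suc zero} _ () | no _
bounce-same-parity {suc m} {suc zero} _ _ | no 1≰m = contradiction (s≤s z≤n) 1≰m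
bounce-same-parity {m} {suc (suc n)} m≤2+n parity | no 2+n≰m =
  trans (bounce-beyond 2+n≰m)
        (bounce-same-parity (≤-same-parity m≤2+n m≢2+n parity) parity)
  where
  m≢2+n : m ≢ suc (suc n)
  m≢2+n refl = 2+n≰m ≤-refl

three-members⇒3≤∣p∣ : ∀ {a} {p : Subset a} {x y z} → x ∈ p → y ∈ p → z ∈ p →
                      x ≢ y → x ≢ z → y ≢ z → 3 ≤ ∣ p ∣
three-members⇒3≤∣p∣ {p = p} {x} {y} {z} x∈p y∈p z∈p x≢y x≢z y≢z =
  ≤-trans (s≤s (≤-trans (s≤s (≤-trans (s≤s z≤n) (x∈p⇒∣p-x∣<∣p∣ z∈p-x-y)))
                        (x∈p⇒∣p-x∣<∣p∣ y∈p-x)))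
          (x∈p⇒∣p-x∣<∣p∣ x∈p)
  where
  y∈p-x : y ∈ p - x
  y∈p-x = x∈p∧x≢y⇒x∈p-y y∈p (λ y≡x → x≢y (≡-sym y≡x))
  z∈p-x-y : z ∈ p - x - y
  z∈p-x-y = x∈p∧x≢y⇒x∈p-y (x∈p∧x≢y⇒x∈p-y z∈p (λ z≡x → x≢z (≡-sym z≡x)))
                            (λ z≡y → y≢z (≡-sym z≡y))

∣p∣≡2⇒z≡x⊎z≡y : ∀ {a} {p : Subset a} {x y z} → ∣ p ∣ ≡ 2 → x ∈ p → y ∈ p → x ≢ y →
                z ∈ p → z ≡ x ⊎ z ≡ y
∣p∣≡2⇒z≡x⊎z≡y {x = x} {y} {z} ∣p∣≡2 x∈p y∈p x≢y z∈p with z ≟ x | z ≟ y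
... | yes z≡x | _ = inj₁ z≡x
... | no _ | yes z≡y = inj₂ z≡y
... | no z≢x | no z≢y =
  contradiction (subst (3 ≤_) ∣p∣≡2 (three-members⇒3≤∣p∣ x∈p y∈p z∈p x≢y
                                       (λ x≡z → z≢x (≡-sym x≡z)) (λ y≡z → z≢y (≡-sym y≡z))))
                λ { (s≤s (s≤s ())) }

Adj-sym : ∀ {G u v} → Adj G u v → Adj G v u
Adj-sym {G} {u} {v} uv = trans (sym G v u) uv

degree-two-neighbours : ∀ {G w x y z} → degree G w ≡ 2 → Adj G w x → Adj G w y → x ≢ y →
                        Adj G w z → z ≡ x ⊎ z ≡ y
degree-two-neighbours {G} {w} deg wx wy x≢y wz =
  ∣p∣≡2⇒z≡x⊎z≡y deg (neighbour∈ wx) (neighbour∈ wy) x≢y (neighbour∈ wz)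
  where
  neighbour∈ : ∀ {v} → Adj G w v → v ∈ tabulate (adj G w)
  neighbour∈ {v} wv = lookup⇒[]= v _ (trans (lookup∘tabulate _ v) wv)

clamp : ∀ len → ℕ → Fin (suc len)
clamp zero _ = Fin.zero
clamp (suc len) zero = Fin.zero
clamp (suc len) (suc k) = Fin.suc (clamp len k)

toℕ-clamp : ∀ {len k} → k ≤ len → toℕ (clamp len k) ≡ k
toℕ-clamp {zero} z≤n = refl
toℕ-clamp {suc len} {zero} _ = refl
toℕ-clamp {suc len} {suc k} (s≤s k≤len) = cong suc (toℕ-clamp k≤len)

clamp-toℕ : ∀ {len} (i : Fin (suc len)) → clamp len (toℕ i) ≡ i
clamp-toℕ {zero} Fin.zero = refl
clamp-toℕ {suc len} Fin.zero = refl
clamp-toℕ {suc len} (Fin.suc i) = cong Fin.suc (clamp-toℕ i)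

module PathIndexing {G : Graph} {len : ℕ} (P : Path G len) where

  at : ℕ → Fin (N G)
  at k = vtx P (clamp len k)

  at-index : ∀ {k} (i : Fin (suc len)) → toℕ i ≡ k → at k ≡ vtx P i
  at-index i refl = cong (vtx P) (clamp-toℕ i)

  at-start : at 0 ≡ start P
  at-start = at-index Fin.zero refl

  at-end : at len ≡ end P
  at-end = at-index (fromℕ len) (toℕ-fromℕ len)

  at-injective : ∀ {j k} → j ≤ len → k ≤ len → at j ≡ at k → j ≡ k
  at-injective {j} {k} j≤len k≤len at-j≡at-k =
    trans (≡-sym (toℕ-clamp j≤len)) (trans (cong toℕ (distinct P at-j≡at-k)) (toℕ-clamp k≤len))

  at-step : ∀ {k} → k < len → Adj G (at k) (at (suc k))
  at-step k<len =
    subst₂ (Adj G) (≡-sym (at-index (inject₁ i) (trans (toℕ-inject₁ i) (toℕ-fromℕ< k<len))))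
                   (≡-sym (at-index (Fin.suc i) (cong suc (toℕ-fromℕ< k<len))))
                   (step P i)
    where
    i = fromℕ< k<len

  0<len⇒start≢end : 0 < len → start P ≢ end P
  0<len⇒start≢end 0<len start≡end =
    <⇒≢ 0<len (at-injective z≤n ≤-refl (trans at-start (trans start≡end (≡-sym at-end))))

  interior? : ∀ v → Dec (Interior P v)
  interior? v = any? λ i → (0 <? toℕ i) ×-dec ((toℕ i <? len) ×-dec (vtx P i ≟ v))

  interior-at : ∀ {k} → 0 < k → k < len → Interior P (at k)
  interior-at {k} 0<k k<len =
    clamp len k , subst (0 <_) (≡-sym k≡) 0<k , subst (_< len) (≡-sym k≡) k<len , refl
    where
    k≡ = toℕ-clamp (<⇒≤ k<len)

  at-interior : ∀ {v} → Interior P v → Σ ℕ λ k → 0 < k × k < len × at k ≡ v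
  at-interior (i , 0<i , i<len , vtx≡v) = toℕ i , 0<i , i<len , trans (at-index i refl) vtx≡v

length-positive : ∀ {G m} (Q : Path G m) → start Q ≢ end Q → 0 < m
length-positive {m = zero} Q start≢end = contradiction refl start≢end
length-positive {m = suc m} _ _ = s≤s z≤n

record PathColouring (a b n : ℕ) (s t : Subset a) : Set where
  field
    colour   : ℕ → Subset a
    size     : ∀ k → k ≤ n → ∣ colour k ∣ ≡ b
    proper   : ∀ k → k < n → colour k ∩ colour (suc k) ≡ ∅
    colour-0 : colour 0 ≡ s
    colour-n : colour n ≡ t

  proper-consecutive : ∀ {j k} → j ≤ n → k ≤ n → Consecutive j k → colour j ∩ colour k ≡ ∅
  proper-consecutive _ k≤n (inj₁ refl) = proper _ k≤n
  proper-consecutive j≤n _ (inj₂ refl) = trans (∩-comm _ _) (proper _ j≤n)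

restrict-to-path : ∀ {G a b S m} (Q : Path G m) (χ : ColorableOn G a b S) → (∀ i → S (vtx Q i)) →
                   PathColouring a b m (proj₁ χ (start Q)) (proj₁ χ (end Q))
restrict-to-path Q (c , c-size , c-proper) on-Q = record
  { colour   = λ k → c (at k)
  ; size     = λ k _ → c-size _ (on-Q _)
  ; proper   = λ k k<m → c-proper _ _ (on-Q _) (on-Q _) (at-step k<m)
  ; colour-0 = cong c at-start
  ; colour-n = cong c at-end
  }
  where open PathIndexing Q

lengthen : ∀ {a b m n s t} → PathColouring a b m s t → m ≤ n → m % 2 ≡ n % 2 → (0 < n → 0 < m) →
           PathColouring a b n s t
lengthen {m = m} {n} C m≤n parity nontrivial = record
  { colour   = λ k → colour (bounce m k)
  ; size     = λ k k≤n → size (bounce m k) (bounded k≤n)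
  ; proper   = λ k k<n → proper-consecutive (bounded (<⇒≤ k<n)) (bounded k<n) (bounce-consecutive m k)
  ; colour-0 = colour-0
  ; colour-n = trans (cong colour (bounce-same-parity m≤n parity)) colour-n
  }
  where
  open PathColouring C
  bounded : ∀ {k} → k ≤ n → bounce m k ≤ m
  bounded {zero} _ = z≤n
  bounded {suc k} 1+k≤n = bounce-≤ (suc k) (nontrivial (≤-trans (s≤s z≤n) 1+k≤n))

module HandleRecolouring {G : Graph} {a b n : ℕ} (H : Path G n)
  (interior-degree : ∀ i → 0 < toℕ i → toℕ i < n → degree G (vtx H i) ≡ 2)
  (c : Fin (N G) → Subset a)
  (c-size : ∀ v → ¬ Interior H v → ∣ c v ∣ ≡ b)
  (c-proper : ∀ u v → ¬ Interior H u → ¬ Interior H v → Adj G u v → c u ∩ c v ≡ ∅)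
  (C : PathColouring a b n (c (start H)) (c (end H))) where

  open PathIndexing H
  open PathColouring C

  recoloured : Fin (N G) → Subset a
  recoloured v with interior? v
  ... | yes (i , _) = colour (toℕ i)
  ... | no _ = c v

  recoloured-size : ∀ v → ∣ recoloured v ∣ ≡ b
  recoloured-size v with interior? v
  ... | yes (i , _ , i<n , _) = size (toℕ i) (<⇒≤ i<n)
  ... | no ¬int = c-size v ¬int

  recoloured-outside : ∀ {v} → ¬ Interior H v → recoloured v ≡ c v
  recoloured-outside {v} ¬int with interior? v
  ... | yes int = contradiction int ¬int
  ... | no _ = refl

  endpoint : ∀ {k} → k ≤ n → ¬ Interior H (at k) → k ≡ 0 ⊎ k ≡ n
  endpoint {zero} _ _ = inj₁ refl
  endpoint {suc k} 1+k≤n ¬int with m≤n⇒m<n∨m≡n 1+k≤n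
  ... | inj₁ 1+k<n = contradiction (interior-at (s≤s z≤n) 1+k<n) ¬int
  ... | inj₂ 1+k≡n = inj₂ 1+k≡n

  recoloured-at : ∀ {k} → k ≤ n → recoloured (at k) ≡ colour k
  recoloured-at {k} k≤n with interior? (at k)
  ... | yes (i , _ , i<n , vtx≡at) =
    cong colour (at-injective (<⇒≤ i<n) k≤n (trans (at-index i refl) vtx≡at))
  ... | no ¬int with endpoint k≤n ¬int
  ...   | inj₁ refl = trans (cong c at-start) (≡-sym colour-0)
  ...   | inj₂ refl = trans (cong c at-end) (≡-sym colour-n)

  degree-at : ∀ {k} → 0 < k → k < n → degree G (at k) ≡ 2
  degree-at {k} 0<k k<n =
    interior-degree (clamp n k) (subst (0 <_) (≡-sym k≡) 0<k) (subst (_< n) (≡-sym k≡) k<n)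
    where
    k≡ = toℕ-clamp (<⇒≤ k<n)

  interior-neighbour : ∀ {k v} → 0 < k → k < n → Adj G (at k) v →
                       Σ ℕ λ j → j ≤ n × Consecutive k j × v ≡ at j
  interior-neighbour {suc k} 0<k 1+k<n adj-v
    with degree-two-neighbours {G} (degree-at 0<k 1+k<n)
           (Adj-sym {G} (at-step (≤-trans (n≤1+n _) 1+k<n))) (at-step 1+k<n) at-k≢at-2+k adj-v
    where
    at-k≢at-2+k : at k ≢ at (suc (suc k))
    at-k≢at-2+k eq = <⇒≢ (s≤s (n≤1+n k)) (at-injective (≤-trans (n≤1+n _) (<⇒≤ 1+k<n)) 1+k<n eq)
  ... | inj₁ v≡at-k = k , ≤-trans (n≤1+n _) (<⇒≤ 1+k<n) , inj₂ refl , v≡at-k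
  ... | inj₂ v≡at-2+k = suc (suc k) , 1+k<n , inj₁ refl , v≡at-2+k

  recoloured-proper-at-interior : ∀ {u v} → Interior H u → Adj G u v → recoloured u ∩ recoloured v ≡ ∅
  recoloured-proper-at-interior int adj with at-interior int
  ... | k , 0<k , k<n , refl with interior-neighbour 0<k k<n adj
  ... | j , j≤n , k~j , refl
    rewrite recoloured-at (<⇒≤ k<n) | recoloured-at j≤n = proper-consecutive (<⇒≤ k<n) j≤n k~j

  recoloured-proper : ∀ {u v} → Adj G u v → recoloured u ∩ recoloured v ≡ ∅
  recoloured-proper {u} {v} adj = by-cases (interior? u) (interior? v)
    where
    by-cases : Dec (Interior H u) → Dec (Interior H v) → recoloured u ∩ recoloured v ≡ ∅
    by-cases (yes int-u) _ = recoloured-proper-at-interior int-u adj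
    by-cases (no _) (yes int-v) = trans (∩-comm _ _) (recoloured-proper-at-interior int-v (Adj-sym {G} adj))
    by-cases (no ¬int-u) (no ¬int-v)
      rewrite recoloured-outside ¬int-u | recoloured-outside ¬int-v = c-proper u v ¬int-u ¬int-v adj

extend-along-handle : ∀ {G a b n} (H : Path G n) →
                      (∀ i → 0 < toℕ i → toℕ i < n → degree G (vtx H i) ≡ 2) →
                      (χ : ColorableOn G a b (λ v → ¬ Interior H v)) →
                      PathColouring a b n (proj₁ χ (start H)) (proj₁ χ (end H)) → Colorable G a b
extend-along-handle H interior-degree (c , c-size , c-proper) C =
  recoloured , (λ v _ → recoloured-size v) , (λ _ _ _ _ → recoloured-proper)
  where open HandleRecolouring H interior-degree c c-size c-proper C

proposition5 : (a b : ℕ) → a > 0 → b > 0 → (G : Graph) → (n : ℕ) → (H : Path G n) →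
    IsParityHandle H → ColorableOn G a b (λ v → Interior H v → ⊥) → Colorable G a b
proposition5 a b _ _ G n H ((_ , interior-degree) , m , Q , m≤n , parity , Q-avoids , Q-start , Q-end) χ =
  extend-along-handle H interior-degree χ
    (subst₂ (PathColouring a b n) (cong (proj₁ χ) Q-start) (cong (proj₁ χ) Q-end)
      (lengthen (restrict-to-path Q χ Q-avoids) m≤n parity Q-nontrivial))
  where
  Q-nontrivial : 0 < n → 0 < m
  Q-nontrivial 0<n = length-positive Q λ start≡end →
    PathIndexing.0<len⇒start≢end H 0<n (trans (≡-sym Q-start) (trans start≡end Q-end))
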